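{- Let $f=\epsilon_1x_1+\dots+\epsilon_nx_n$ with $\epsilon_i\in\{ -1,1\}$, viewed over $\mathbb{Q}$. Then every tree-like $\mathrm{Res}_{sw}(\mathrm{lin}_{\mathbb{Q}})$ refutation of $\neg\mathrm{Im}(f)$ has size at least $2^{n/4}$.
   Context: $im_2(f)$ is the set of values of $f$ under 0-1 assignments. For $A$ in the ring, $\langle f\ne A\rangle$ denotes the linear clause $\bigvee_{B\in im_2(f),\,B\ne A}(f=B)$, and $\neg\mathrm{Im}(f):=\{\langle f\ne A\rangle : A\in im_2(f)\}$ (an unsatisfiable set of linear clauses). A linear clause is a disjunction of linear equations (duplicates identified); variables range over $\{0,1\}$ and $\models$ is semantic implication with respect to 0-1 assignments. The system $\mathrm{Res}_{sw}(\mathrm{lin}_{\mathbb{Q}})$ has the single axiom $0=0$ and the rules: resolution (from $C\vee f=0$ and $D\vee g=0$ derive $C\vee D\vee(\alpha f+\beta g=0)$, $\alpha,\beta\in\mathbb{Q}$) and semantic weakening (from $C$ derive any linear clause $D$ with $C\models D$). A refutation is a sequence of linear clauses ending in the empty clause, each a hypothesis, the axiom, or obtained from earlier ones by a rule; tree-like means each occurrence of a clause is used at most once as a premise. Size is total number of variable occurrences plus total bit-size of coefficients. -}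

module Defs where

open import Data.Nat using (ℕ; zero; suc; _+_)
open import Data.Nat.Logarithm using (⌊log₂_⌋)
open import Data.Integer using (∣_∣)
open import Data.Rational using (ℚ; 0ℚ; 1ℚ; -_)
  renaming (_+_ to _+ℚ_; _*_ to _*ℚ_; _-_ to _-ℚ_; _≟_ to _≟ℚ_)
open import Data.Bool using (Bool; true; false)
open import Data.Sign using (Sign)
open import Data.Vec using (Vec; []; _∷_; zipWith; map; foldr; replicate)
import Data.Vec.Properties as VecP
import Data.Product.Properties as ProdP
open import Data.Product using (_×_; _,_; Σ; ∃; proj₁; proj₂)
open import Data.List using (List; []; _∷_; [_]; _++_; deduplicate)
open import Data.List.Membership.Propositional using (_∈_)
open import Data.List.Relation.Unary.Any using (Any)
open import Relation.Binary.PropositionalEquality using (_≡_; _≢_)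
open import Relation.Binary.Definitions using (DecidableEquality)
open import Relation.Nullary using (does)

-- Linear forms over ℚ in variables x₀ … x_{n-1}:
--   (c , a) stands for  a₀x₀ + … + a_{n-1}x_{n-1} + c.
-- A linear equation "L = 0" is represented by the linear form L.

Lin : ℕ → Set
Lin n = ℚ × Vec ℚ n

_≟Lin_ : ∀ {n} → DecidableEquality (Lin n)
_≟Lin_ = ProdP.≡-dec _≟ℚ_ (VecP.≡-dec _≟ℚ_)

Assignment : ℕ → Set
Assignment n = Vec Bool n

bit : Bool → ℚ
bit true  = 1ℚ
bit false = 0ℚ

eval : ∀ {n} → Lin n → Assignment n → ℚ
eval (c , a) x = foldr _ _+ℚ_ c (zipWith (λ ai xi → ai *ℚ bit xi) a x)

lincomb : ∀ {n} → ℚ → Lin n → ℚ → Lin n → Lin n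
lincomb α (c , a) β (d , b) =
  (α *ℚ c +ℚ β *ℚ d , zipWith (λ ai bi → α *ℚ ai +ℚ β *ℚ bi) a b)

zeroEq : ∀ {n} → Lin n
zeroEq {n} = 0ℚ , replicate n 0ℚ

-- Linear clauses: lists of linear equations, read as disjunctions;
-- duplicates identified (clauses are compared up to set equality and
-- size is computed after deduplication).

Clause : ℕ → Set
Clause n = List (Lin n)

SatEq : ∀ {n} → Assignment n → Lin n → Set
SatEq x L = eval L x ≡ 0ℚ

Sat : ∀ {n} → Assignment n → Clause n → Set
Sat x C = Any (SatEq x) C

_⊨_ : ∀ {n} → Clause n → Clause n → Set
C ⊨ D = ∀ x → Sat x C → Sat x D

_≈_ : ∀ {n} → Clause n → Clause n → Set
C ≈ D = ∀ L → (L ∈ C → L ∈ D) × (L ∈ D → L ∈ C)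

-- number of binary digits of a natural number (0 has one digit)
bitlen : ℕ → ℕ
bitlen m = suc ⌊log₂ m ⌋

bitsizeℚ : ℚ → ℕ
bitsizeℚ q = bitlen ∣ ℚ.numerator q ∣ + bitlen (ℚ.denominatorℕ q)

-- size of a coefficient of a variable: one variable occurrence plus its
-- bit-size if the coefficient is nonzero, nothing otherwise
coeffSize : ℚ → ℕ
coeffSize a with does (a ≟ℚ 0ℚ)
... | true  = 0
... | false = suc (bitsizeℚ a)

constSize : ℚ → ℕ
constSize c with does (c ≟ℚ 0ℚ)
... | true  = 0
... | false = bitsizeℚ c

eqSize : ∀ {n} → Lin n → ℕ
eqSize (c , a) = constSize c + foldr _ (λ ai s → coeffSize ai + s) 0 a

sumSizes : ∀ {n} → Clause n → ℕ
sumSizes []      = 0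
sumSizes (L ∷ C) = eqSize L + sumSizes C

clauseSize : ∀ {n} → Clause n → ℕ
clauseSize C = sumSizes (deduplicate _≟Lin_ C)

-- Tree-like Res_sw(lin_ℚ) derivations from a set of hypotheses H,
-- as derivation trees; each node is a line of the proof.

data Deriv {n : ℕ} (H : Clause n → Set) : Clause n → Set where
  hyp  : ∀ {C} → H C → Deriv H C
  ax   : Deriv H [ zeroEq ]
  res  : ∀ {P₁ P₂ Q} (C D : Clause n) (f g : Lin n) (α β : ℚ) →
         Deriv H P₁ → Deriv H P₂ →
         P₁ ≈ (f ∷ C) → P₂ ≈ (g ∷ D) →
         Q ≈ (C ++ D ++ [ lincomb α f β g ]) →
         Deriv H Q
  weak : ∀ {C D} → Deriv H C → C ⊨ D → Deriv H D

size : ∀ {n} {H : Clause n → Set} {C : Clause n} → Deriv H C → ℕ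
size {C = C} (hyp _)               = clauseSize C
size {C = C} ax                    = clauseSize C
size {C = Q} (res _ _ _ _ _ _ d e _ _ _) = clauseSize Q + size d + size e
size {C = D} (weak d _)            = clauseSize D + size d

Refutation : ∀ {n} → (Clause n → Set) → Set
Refutation H = Deriv H []

signℚ : Sign → ℚ
signℚ Sign.+ = 1ℚ
signℚ Sign.- = - 1ℚ

fOf : ∀ {n} → Vec Sign n → Lin n
fOf ε = 0ℚ , map signℚ ε

-- the equation  f = B,  i.e.  f - B = 0
fEq : ∀ {n} → Vec Sign n → ℚ → Lin n
fEq ε B = (- B) , map signℚ ε

Im₂ : ∀ {n} → Lin n → ℚ → Set
Im₂ {n} f A = Σ (Assignment n) λ x → eval f x ≡ A

-- C is (up to identification of duplicates) the clause ⟨f ≠ A⟩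
IsNeq : ∀ {n} → Vec Sign n → ℚ → Clause n → Set
IsNeq ε A C = ∀ L → (L ∈ C → Σ ℚ λ B → Im₂ (fOf ε) B × B ≢ A × L ≡ fEq ε B)
                  × (∀ B → Im₂ (fOf ε) B → B ≢ A → fEq ε B ∈ C)

NotIm : ∀ {n} → Vec Sign n → Clause n → Set
NotIm ε C = Σ ℚ λ A → Im₂ (fOf ε) A × IsNeq ε A C

module Submission where

-- Walk down a refutation π from the root, keeping a
--    list E of linear forms and the region R of 0-1 points on which all
--    forms of E are nonzero; every point of R falsifies the current clause.
--    At a resolution step we enter the smaller premise, adding its resolved
--    form to E if it is nonzero somewhere on R (this at most doubles the
--    "cost" 2^|E| relative to the size), and otherwise enter the other
--    premise without changing E.  At a leaf ⟨f ≠ A⟩ every point of R has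
--    f = A.  Result: 2^|E| ≤ size π and f is constant on a nonempty R.
-- 2. Polynomial method.  For a sign s, the subcube through a point q of the
--    coordinates whose flip moves f in direction s has f(x) ≠ f(q) for all
--    x ≠ q in it, so E covers this subcube except q.  The alternating sum
--    over a subcube kills polynomials of degree < its dimension, but not
--    the product of E (degree |E|), so the dimension is at most |E|.  One
--    of the two signs gives dimension ≥ n/2, hence n ≤ 2|E|.

open import Defs
open import Data.Nat using (ℕ; _≤_; _^_)
open import Data.Vec using (Vec)
open import Data.Sign using (Sign)

open import Data.Sign using (opposite)
open import Data.Nat using (zero; suc; _+_; _*_; _<_; z≤n; s≤s; _≤?_; NonZero; >-nonZero)
import Data.Nat.Properties as ℕₚ
import Data.Nat.Solver as ℕSolver
open import Data.Rational as Q using (ℚ; 0ℚ; 1ℚ)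
  renaming (_+_ to _+ℚ_; _*_ to _*ℚ_; _-_ to _-ℚ_)
import Data.Rational.Properties as QP
import Data.Rational.Solver as QSolver
import Algebra.Properties.Group as GroupProperties
open import Data.Bool using (Bool; true; false; not)
import Data.Bool.Properties as Boolₚ
import Data.Sign.Properties as Signₚ
open import Data.Vec using ([]; _∷_; replicate; map)
open import Data.List using (List; []; _∷_; _++_; length; [_])
open import Data.List.Relation.Unary.All as All using (All; []; _∷_)
open import Data.List.Relation.Unary.Any using (here; there)
open import Data.List.Membership.Propositional using (_∈_; lose; find)
open import Data.List.Membership.Propositional.Properties using (∈-++⁺ˡ; ∈-++⁺ʳ)
open import Data.Product using (Σ; _×_; _,_; proj₁; proj₂)
open import Data.Sum using (_⊎_; inj₁; inj₂; [_,_]′)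
open import Data.Unit using (⊤; tt)
open import Data.Empty using (⊥; ⊥-elim)
open import Relation.Nullary using (¬_; Dec; yes; no; ¬?; does; _×-dec_)
open import Relation.Binary.PropositionalEquality hiding ([_])

module RingIdentities where
  open QSolver.+-*-Solver

  sub-interchange : ∀ a b c d → (a -ℚ b) -ℚ (c -ℚ d) ≡ (a -ℚ c) -ℚ (b -ℚ d)
  sub-interchange = solve 4 (λ a b c d → (a :- b) :- (c :- d) := (a :- c) :- (b :- d)) refl

  add-of-subs : ∀ a b c d → (a -ℚ b) +ℚ (c -ℚ d) ≡ (a +ℚ c) -ℚ (b +ℚ d)
  add-of-subs = solve 4 (λ a b c d → (a :- b) :+ (c :- d) := (a :+ c) :- (b :+ d)) refl

  sub-zero : ∀ a → a -ℚ 0ℚ ≡ a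
  sub-zero = solve 1 (λ a → a :- con 0ℚ := a) refl

  -- the three shapes of the product rule  uw(1) − uw(0)
  product-rule-const-w : ∀ u₁ u₀ w → (u₁ -ℚ u₀) *ℚ w ≡ u₁ *ℚ w -ℚ u₀ *ℚ w
  product-rule-const-w = solve 3 (λ u₁ u₀ w → (u₁ :- u₀) :* w := u₁ :* w :- u₀ :* w) refl

  product-rule-const-u : ∀ u w₁ w₀ → u *ℚ (w₁ -ℚ w₀) ≡ u *ℚ w₁ -ℚ u *ℚ w₀
  product-rule-const-u = solve 3 (λ u w₁ w₀ → u :* (w₁ :- w₀) := u :* w₁ :- u :* w₀) refl

  product-rule : ∀ u₁ u₀ w₁ w₀ →
    (u₁ -ℚ u₀) *ℚ w₁ +ℚ u₀ *ℚ (w₁ -ℚ w₀) ≡ u₁ *ℚ w₁ -ℚ u₀ *ℚ w₀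
  product-rule = solve 4 (λ u₁ u₀ w₁ w₀ →
    (u₁ :- u₀) :* w₁ :+ u₀ :* (w₁ :- w₀) := u₁ :* w₁ :- u₀ :* w₀) refl

  linear-difference : ∀ a e → a ≡ (a *ℚ 1ℚ +ℚ e) -ℚ (a *ℚ 0ℚ +ℚ e)
  linear-difference = solve 2 (λ a e → a := (a :* con 1ℚ :+ e) :- (a :* con 0ℚ :+ e)) refl

  add-left-comm : ∀ a c e → a +ℚ (c +ℚ e) ≡ c +ℚ (a +ℚ e)
  add-left-comm = solve 3 (λ a c e → a :+ (c :+ e) := c :+ (a :+ e)) refl

  lincomb-step : ∀ α β a b y r s →
    (α *ℚ a +ℚ β *ℚ b) *ℚ y +ℚ (α *ℚ r +ℚ β *ℚ s) ≡ α *ℚ (a *ℚ y +ℚ r) +ℚ β *ℚ (b *ℚ y +ℚ s)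
  lincomb-step = solve 7 (λ α β a b y r s →
    (α :* a :+ β :* b) :* y :+ (α :* r :+ β :* s) := α :* (a :* y :+ r) :+ β :* (b :* y :+ s)) refl

  lincomb-zeros : ∀ α β → α *ℚ 0ℚ +ℚ β *ℚ 0ℚ ≡ 0ℚ
  lincomb-zeros = solve 2 (λ α β → α :* con 0ℚ :+ β :* con 0ℚ := con 0ℚ) refl

  shift-assoc : ∀ a e s K → a +ℚ (e +ℚ s *ℚ K) ≡ (a +ℚ e) +ℚ s *ℚ K
  shift-assoc = solve 4 (λ a e s K → a :+ (e :+ s :* K) := (a :+ e) :+ s :* K) refl

  shift-step : ∀ a s e K → (a +ℚ s) +ℚ (e +ℚ s *ℚ K) ≡ (a +ℚ e) +ℚ s *ℚ (1ℚ +ℚ K)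
  shift-step = solve 4 (λ a s e K → (a :+ s) :+ (e :+ s :* K) := (a :+ e) :+ s :* (con 1ℚ :+ K)) refl

open RingIdentities

double-product : ∀ P s → (2 * P) * s ≡ P * (s + s)
double-product = solve 2 (λ P s → (con 2 :* P) :* s := P :* (s :+ s)) refl
  where open ℕSolver.+-*-Solver

open GroupProperties QP.+-0-group using (x∙y⁻¹≈ε⇒x≈y; x≈y⇒x∙y⁻¹≈ε; identityʳ-unique)

*-nonZero : ∀ a b → a ≢ 0ℚ → b ≢ 0ℚ → a *ℚ b ≢ 0ℚ
*-nonZero a b a≢0 b≢0 ab≡0 = b≢0 (begin
    b                    ≡⟨ sym (QP.*-identityˡ b) ⟩
    1ℚ *ℚ b              ≡⟨ cong (_*ℚ b) (sym (QP.*-inverseˡ a)) ⟩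
    (Q.1/ a *ℚ a) *ℚ b   ≡⟨ QP.*-assoc (Q.1/ a) a b ⟩
    Q.1/ a *ℚ (a *ℚ b)   ≡⟨ cong (Q.1/ a *ℚ_) ab≡0 ⟩
    Q.1/ a *ℚ 0ℚ         ≡⟨ QP.*-zeroʳ (Q.1/ a) ⟩
    0ℚ                   ∎)
  where
  open ≡-Reasoning
  instance
    a-nonZero : Q.NonZero a
    a-nonZero = Q.≢-nonZero a≢0

sign≢0 : ∀ s → signℚ s ≢ 0ℚ
sign≢0 Sign.+ ()
sign≢0 Sign.- ()

value : ∀ {n} → Vec Sign n → Assignment n → ℚ
value ε x = eval (fOf ε) x

eval-const : ∀ {n} c (a : Vec ℚ n) x → eval (c , a) x ≡ c +ℚ eval (0ℚ , a) x
eval-const c [] [] = sym (QP.+-identityʳ c)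
eval-const c (a₀ ∷ a) (b ∷ x) =
  trans (cong (a₀ *ℚ bit b +ℚ_) (eval-const c a x)) (add-left-comm (a₀ *ℚ bit b) c (eval (0ℚ , a) x))

eval-lincomb : ∀ {n} α β (f g : Lin n) x →
  eval (lincomb α f β g) x ≡ α *ℚ eval f x +ℚ β *ℚ eval g x
eval-lincomb α β (c , []) (d , []) [] = refl
eval-lincomb α β (c , a₀ ∷ a) (d , b₀ ∷ b) (y ∷ x) =
  trans (cong ((α *ℚ a₀ +ℚ β *ℚ b₀) *ℚ bit y +ℚ_) (eval-lincomb α β (c , a) (d , b) x))
        (lincomb-step α β a₀ b₀ (bit y) (eval (c , a) x) (eval (d , b) x))

fEq-holds : ∀ {n} (ε : Vec Sign n) B x → value ε x ≡ B → eval (fEq ε B) x ≡ 0ℚ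
fEq-holds ε B x fx≡B = trans (eval-const (Q.- B) (map signℚ ε) x)
                             (trans (cong (Q.- B +ℚ_) fx≡B) (QP.+-inverseˡ B))

zeroEq-holds : ∀ {n} (x : Assignment n) → eval (zeroEq {n}) x ≡ 0ℚ
zeroEq-holds [] = refl
zeroEq-holds (b ∷ x) = cong₂ _+ℚ_ (QP.*-zeroˡ (bit b)) (zeroEq-holds x)

value-origin : ∀ {n} (ε : Vec Sign n) → value ε (replicate n false) ≡ 0ℚ
value-origin [] = refl
value-origin (σ ∷ ε) = cong₂ _+ℚ_ (QP.*-zeroʳ (signℚ σ)) (value-origin ε)

value-unit : ∀ {n} σ (ε : Vec Sign n) → value (σ ∷ ε) (true ∷ replicate n false) ≢ 0ℚ
value-unit σ ε f≡0 = sign≢0 σ (begin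
  signℚ σ                                    ≡⟨ sym (QP.*-identityʳ (signℚ σ)) ⟩
  signℚ σ *ℚ 1ℚ                              ≡⟨ sym (QP.+-identityʳ _) ⟩
  signℚ σ *ℚ 1ℚ +ℚ 0ℚ                        ≡⟨ cong (signℚ σ *ℚ 1ℚ +ℚ_) (sym (value-origin ε)) ⟩
  value (σ ∷ ε) (true ∷ replicate _ false)   ≡⟨ f≡0 ⟩
  0ℚ                                         ∎)
  where open ≡-Reasoning

-- For n ≥ 1, f takes at least two values, so every A misses some value.
other-value : ∀ {m} (ε : Vec Sign (suc m)) A → Σ ℚ λ B → Im₂ (fOf ε) B × B ≢ A
other-value {m} (σ ∷ ε) A with A QP.≟ 0ℚ
... | yes A≡0 = value (σ ∷ ε) e₁ , (e₁ , refl) , λ B≡A → value-unit σ ε (trans B≡A A≡0)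
  where e₁ = true ∷ replicate m false
... | no  A≢0 = value (σ ∷ ε) o , (o , refl) , λ B≡A → A≢0 (trans (sym B≡A) (value-origin (σ ∷ ε)))
  where o = replicate (suc m) false

-- For n ≥ 1 each equation f = B has size ≥ 1: the coefficient ±1 of x₁ counts.
fEq-size : ∀ {m} (ε : Vec Sign (suc m)) B → 1 ≤ eqSize (fEq ε B)
fEq-size (Sign.+ ∷ _) B = ℕₚ.≤-trans (s≤s z≤n) (ℕₚ.m≤n+m _ (constSize (Q.- B)))
fEq-size (Sign.- ∷ _) B = ℕₚ.≤-trans (s≤s z≤n) (ℕₚ.m≤n+m _ (constSize (Q.- B)))

-- ⟨f ≠ A⟩ is nonempty since f takes a value other than A, and each of its
-- equations has size ≥ 1; so hypotheses have size ≥ 1.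
neq-clause-size : ∀ {m} (ε : Vec Sign (suc m)) {A} C → IsNeq ε A C → 1 ≤ clauseSize C
neq-clause-size ε {A} [] isNeq with other-value ε A
... | B , imB , B≢A with () ← proj₂ (isNeq (fEq ε B)) B imB B≢A
neq-clause-size ε (L ∷ C) isNeq with proj₁ (isNeq L) (here refl)
... | B , _ , _ , refl = ℕₚ.≤-trans (fEq-size ε B) (ℕₚ.m≤m+n _ _)

-- Functions on the cube, finite differences and degree

CubeFn : ℕ → Set
CubeFn n = Assignment n → ℚ

_≐_ : ∀ {n} → CubeFn n → CubeFn n → Set
u ≐ w = ∀ x → u x ≡ w x

fix : ∀ {n} → Bool → CubeFn (suc n) → CubeFn n
fix b v x = v (b ∷ x)

Δ : ∀ {n} → CubeFn (suc n) → CubeFn n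
Δ v x = v (true ∷ x) -ℚ v (false ∷ x)

-- A mask M : Vec Bool n marks the free coordinates of a subcube; its
-- dimension is the number of free coordinates.
dim : ∀ {n} → Vec Bool n → ℕ
dim [] = 0
dim (true ∷ M) = suc (dim M)
dim (false ∷ M) = dim M

InSubcube : ∀ {n} → Vec Bool n → Vec Bool n → Assignment n → Set
InSubcube [] [] [] = ⊤
InSubcube (b ∷ p) (false ∷ M) (c ∷ x) = c ≡ b × InSubcube p M x
InSubcube (b ∷ p) (true ∷ M) (c ∷ x) = InSubcube p M x

-- Alternating sum of v over the subcube (p , M): each point is weighted
-- by (−1)^(number of free coordinates where it differs from p).
altSum : ∀ {n} → Vec Bool n → Vec Bool n → CubeFn n → ℚ
altSum [] [] v = v []
altSum (b ∷ p) (false ∷ M) v = altSum p M (fix b v)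
altSum (b ∷ p) (true ∷ M) v = altSum p M (fix b v) -ℚ altSum p M (fix (not b) v)

-- Deg M d v: in the free coordinates M, v is a polynomial of degree ≤ d.
Deg : ∀ {n} → Vec Bool n → ℕ → CubeFn n → Set
Deg [] d v = ⊤
Deg (false ∷ M) d v = ∀ b → Deg M d (fix b v)
Deg (true ∷ M) zero v = (∀ b → Deg M zero (fix b v)) × (fix true v ≐ fix false v)
Deg (true ∷ M) (suc d) v = (∀ b → Deg M (suc d) (fix b v)) × Deg M d (Δ v)

altSum-cong : ∀ {n} (p M : Vec Bool n) {u w : CubeFn n} → u ≐ w → altSum p M u ≡ altSum p M w
altSum-cong [] [] u≐w = u≐w []
altSum-cong (b ∷ p) (false ∷ M) u≐w = altSum-cong p M (λ x → u≐w (b ∷ x))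
altSum-cong (b ∷ p) (true ∷ M) u≐w =
  cong₂ _-ℚ_ (altSum-cong p M (λ x → u≐w (b ∷ x))) (altSum-cong p M (λ x → u≐w (not b ∷ x)))

altSum-sub : ∀ {n} (p M : Vec Bool n) (u w : CubeFn n) →
  altSum p M (λ x → u x -ℚ w x) ≡ altSum p M u -ℚ altSum p M w
altSum-sub [] [] u w = refl
altSum-sub (b ∷ p) (false ∷ M) u w = altSum-sub p M (fix b u) (fix b w)
altSum-sub (b ∷ p) (true ∷ M) u w =
  trans (cong₂ _-ℚ_ (altSum-sub p M (fix b u) (fix b w)) (altSum-sub p M (fix (not b) u) (fix (not b) w)))
        (sub-interchange (altSum p M (fix b u)) (altSum p M (fix b w))
                         (altSum p M (fix (not b) u)) (altSum p M (fix (not b) w)))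

sub≡0-sym : ∀ a b → a -ℚ b ≡ 0ℚ → b -ℚ a ≡ 0ℚ
sub≡0-sym a b a-b≡0 = x≈y⇒x∙y⁻¹≈ε (sym (x∙y⁻¹≈ε⇒x≈y a b a-b≡0))

-- The alternating sum over a subcube kills polynomials of degree below
-- its dimension: each free coordinate lowers the degree by one.
altSum-vanishes : ∀ {n} (p M : Vec Bool n) d (v : CubeFn n) → Deg M d v → d < dim M →
  altSum p M v ≡ 0ℚ
altSum-vanishes [] [] d v _ ()
altSum-vanishes (b ∷ p) (false ∷ M) d v deg d<dim = altSum-vanishes p M d (fix b v) (deg b) d<dim
altSum-vanishes (b ∷ p) (true ∷ M) zero v (_ , faces-equal) _ =
  x≈y⇒x∙y⁻¹≈ε (altSum-cong p M (faces b))
  where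
  faces : ∀ b → fix b v ≐ fix (not b) v
  faces true = faces-equal
  faces false x = sym (faces-equal x)
altSum-vanishes (b ∷ p) (true ∷ M) (suc d) v (_ , deg-Δ) (s≤s d<dim) = oriented b
  where
  true-first : altSum p M (fix true v) -ℚ altSum p M (fix false v) ≡ 0ℚ
  true-first = trans (sym (altSum-sub p M (fix true v) (fix false v)))
                     (altSum-vanishes p M d (Δ v) deg-Δ d<dim)
  oriented : ∀ b → altSum p M (fix b v) -ℚ altSum p M (fix (not b) v) ≡ 0ℚ
  oriented true = true-first
  oriented false = sub≡0-sym (altSum p M (fix true v)) (altSum p M (fix false v)) true-first

altSum-zero : ∀ {n} (p M : Vec Bool n) (v : CubeFn n) →
  (∀ x → InSubcube p M x → v x ≡ 0ℚ) → altSum p M v ≡ 0ℚ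
altSum-zero [] [] v zero-on = zero-on [] tt
altSum-zero (b ∷ p) (false ∷ M) v zero-on = altSum-zero p M (fix b v) (λ x x∈ → zero-on (b ∷ x) (refl , x∈))
altSum-zero (b ∷ p) (true ∷ M) v zero-on =
  trans (cong₂ _-ℚ_ (altSum-zero p M (fix b v) (λ x → zero-on (b ∷ x)))
                    (altSum-zero p M (fix (not b) v) (λ x → zero-on (not b ∷ x))))
        (sub-zero 0ℚ)

altSum-point : ∀ {n} (p M : Vec Bool n) (v : CubeFn n) →
  (∀ x → InSubcube p M x → x ≢ p → v x ≡ 0ℚ) → altSum p M v ≡ v p
altSum-point [] [] v zero-off = refl
altSum-point (b ∷ p) (false ∷ M) v zero-off =
  altSum-point p M (fix b v) (λ x x∈ x≢p → zero-off (b ∷ x) (refl , x∈) (λ { refl → x≢p refl }))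
altSum-point (b ∷ p) (true ∷ M) v zero-off =
  trans (cong₂ _-ℚ_ (altSum-point p M (fix b v) (λ x x∈ x≢p → zero-off (b ∷ x) x∈ (λ { refl → x≢p refl })))
                    (altSum-zero p M (fix (not b) v) (λ x x∈ → zero-off (not b ∷ x) x∈ (other-face b))))
        (sub-zero _)
  where
  other-face : ∀ b {x} → (not b ∷ x) ≢ (b ∷ p)
  other-face true ()
  other-face false ()

Deg-cong : ∀ {n} (M : Vec Bool n) d {u w : CubeFn n} → u ≐ w → Deg M d u → Deg M d w
Deg-cong [] d u≐w deg = tt
Deg-cong (false ∷ M) d u≐w deg = λ b → Deg-cong M d (λ x → u≐w (b ∷ x)) (deg b)
Deg-cong (true ∷ M) zero u≐w (deg , faces-equal) =
  (λ b → Deg-cong M zero (λ x → u≐w (b ∷ x)) (deg b)) ,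
  (λ x → trans (sym (u≐w (true ∷ x))) (trans (faces-equal x) (u≐w (false ∷ x))))
Deg-cong (true ∷ M) (suc d) u≐w (deg , deg-Δ) =
  (λ b → Deg-cong M (suc d) (λ x → u≐w (b ∷ x)) (deg b)) ,
  Deg-cong M d (λ x → cong₂ _-ℚ_ (u≐w (true ∷ x)) (u≐w (false ∷ x))) deg-Δ

Deg-const : ∀ {n} (M : Vec Bool n) d k → Deg M d (λ _ → k)
Deg-const [] d k = tt
Deg-const (false ∷ M) d k = λ b → Deg-const M d k
Deg-const (true ∷ M) zero k = (λ b → Deg-const M zero k) , (λ x → refl)
Deg-const (true ∷ M) (suc d) k =
  (λ b → Deg-const M (suc d) k) , Deg-cong M d (λ x → sym (QP.+-inverseʳ k)) (Deg-const M d 0ℚ)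

Deg-add : ∀ {n} (M : Vec Bool n) d {u w : CubeFn n} → Deg M d u → Deg M d w →
  Deg M d (λ x → u x +ℚ w x)
Deg-add [] d deg-u deg-w = tt
Deg-add (false ∷ M) d deg-u deg-w = λ b → Deg-add M d (deg-u b) (deg-w b)
Deg-add (true ∷ M) zero (deg-u , eq-u) (deg-w , eq-w) =
  (λ b → Deg-add M zero (deg-u b) (deg-w b)) , (λ x → cong₂ _+ℚ_ (eq-u x) (eq-w x))
Deg-add (true ∷ M) (suc d) {u} {w} (deg-u , Δu) (deg-w , Δw) =
  (λ b → Deg-add M (suc d) (deg-u b) (deg-w b)) ,
  Deg-cong M d (λ x → add-of-subs (u (true ∷ x)) (u (false ∷ x)) (w (true ∷ x)) (w (false ∷ x)))
    (Deg-add M d Δu Δw)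

-- Degrees add under multiplication, via the product rule
-- Δ(uw) = (Δu)·w(1,·) + u(0,·)·(Δw).
Deg-mul : ∀ {n} (M : Vec Bool n) d e {u w : CubeFn n} → Deg M d u → Deg M e w →
  Deg M (d + e) (λ x → u x *ℚ w x)
Deg-mul [] d e deg-u deg-w = tt
Deg-mul (false ∷ M) d e deg-u deg-w = λ b → Deg-mul M d e (deg-u b) (deg-w b)
Deg-mul (true ∷ M) zero zero (deg-u , eq-u) (deg-w , eq-w) =
  (λ b → Deg-mul M zero zero (deg-u b) (deg-w b)) , (λ x → cong₂ _*ℚ_ (eq-u x) (eq-w x))
Deg-mul (true ∷ M) (suc d) zero {u} {w} (deg-u , Δu) (deg-w , eq-w) =
  (λ b → Deg-mul M (suc d) zero (deg-u b) (deg-w b)) ,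
  Deg-cong M (d + zero)
    (λ x → trans (product-rule-const-w (u (true ∷ x)) (u (false ∷ x)) (w (true ∷ x)))
                 (cong (λ z → u (true ∷ x) *ℚ w (true ∷ x) -ℚ u (false ∷ x) *ℚ z) (eq-w x)))
    (Deg-mul M d zero Δu (deg-w true))
Deg-mul (true ∷ M) zero (suc e) {u} {w} (deg-u , eq-u) (deg-w , Δw) =
  (λ b → Deg-mul M zero (suc e) (deg-u b) (deg-w b)) ,
  Deg-cong M e
    (λ x → trans (product-rule-const-u (u (true ∷ x)) (w (true ∷ x)) (w (false ∷ x)))
                 (cong (λ z → u (true ∷ x) *ℚ w (true ∷ x) -ℚ z *ℚ w (false ∷ x)) (eq-u x)))
    (Deg-mul M zero e (deg-u true) Δw)
Deg-mul (true ∷ M) (suc d) (suc e) {u} {w} (deg-u , Δu) (deg-w , Δw) =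
  (λ b → Deg-mul M (suc d) (suc e) (deg-u b) (deg-w b)) ,
  Deg-cong M (d + suc e) (λ x → product-rule (u (true ∷ x)) (u (false ∷ x)) (w (true ∷ x)) (w (false ∷ x)))
    (Deg-add M (d + suc e) (Deg-mul M d (suc e) Δu (deg-w true))
      (subst (λ k → Deg M k (λ x → u (false ∷ x) *ℚ Δ w x)) (sym (ℕₚ.+-suc d e))
             (Deg-mul M (suc d) e (deg-u false) Δw)))

Deg-lin : ∀ {n} (M : Vec Bool n) (L : Lin n) → Deg M 1 (eval L)
Deg-lin [] (c , []) = tt
Deg-lin (false ∷ M) (c , a₀ ∷ a) = λ b → Deg-add M 1 (Deg-const M 1 (a₀ *ℚ bit b)) (Deg-lin M (c , a))
Deg-lin (true ∷ M) (c , a₀ ∷ a) =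
  (λ b → Deg-add M 1 (Deg-const M 1 (a₀ *ℚ bit b)) (Deg-lin M (c , a))) ,
  Deg-cong M 0 (λ x → linear-difference a₀ (eval (c , a) x)) (Deg-const M 0 a₀)

product : ∀ {n} → List (Lin n) → CubeFn n
product [] x = 1ℚ
product (L ∷ Ls) x = eval L x *ℚ product Ls x

Deg-product : ∀ {n} (M : Vec Bool n) (Ls : List (Lin n)) → Deg M (length Ls) (product Ls)
Deg-product M [] = Deg-const M 0 1ℚ
Deg-product M (L ∷ Ls) = Deg-mul M 1 (length Ls) (Deg-lin M L) (Deg-product M Ls)

-- Covering a subcube minus a point by hyperplanes

Avoids : ∀ {n} → List (Lin n) → Assignment n → Set
Avoids Ls x = All (λ L → eval L x ≢ 0ℚ) Ls

avoids? : ∀ {n} (Ls : List (Lin n)) x → Dec (Avoids Ls x)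
avoids? Ls x = All.all? (λ L → ¬? (eval L x QP.≟ 0ℚ)) Ls

product-zero : ∀ {n} (Ls : List (Lin n)) x → ¬ Avoids Ls x → product Ls x ≡ 0ℚ
product-zero [] x not-avoids = ⊥-elim (not-avoids [])
product-zero (L ∷ Ls) x not-avoids with eval L x QP.≟ 0ℚ
... | yes Lx≡0 = trans (cong (_*ℚ product Ls x) Lx≡0) (QP.*-zeroˡ (product Ls x))
... | no  Lx≢0 = trans (cong (eval L x *ℚ_) (product-zero Ls x (λ avoids → not-avoids (Lx≢0 ∷ avoids))))
                      (QP.*-zeroʳ (eval L x))

product-nonZero : ∀ {n} (Ls : List (Lin n)) x → Avoids Ls x → product Ls x ≢ 0ℚ
product-nonZero [] x _ = λ ()
product-nonZero (L ∷ Ls) x (Lx≢0 ∷ avoids) = *-nonZero _ _ Lx≢0 (product-nonZero Ls x avoids)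

-- Hyperplanes covering a subcube except one of its points number at
-- least its dimension: otherwise the product of the forms would be a
-- polynomial of degree < dim with nonzero alternating sum.
covering-bound : ∀ {n} (p M : Vec Bool n) (E : List (Lin n)) → Avoids E p →
  (∀ x → InSubcube p M x → x ≢ p → ¬ Avoids E x) → dim M ≤ length E
covering-bound p M E p-avoids covered = ℕₚ.≮⇒≥ λ |E|<dim →
  product-nonZero E p p-avoids (begin
    product E p
      ≡⟨ sym (altSum-point p M (product E) (λ x x∈ x≢p → product-zero E x (covered x x∈ x≢p))) ⟩
    altSum p M (product E)
      ≡⟨ altSum-vanishes p M (length E) (product E) (Deg-product M E) |E|<dim ⟩
    0ℚ ∎)
  where open ≡-Reasoning

-- the direction in which f moves when a coordinate of sign σ, currently
-- equal to b, is flipped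
flipDirection : Sign → Bool → Sign
flipDirection σ false = σ
flipDirection σ true = opposite σ

flip-change : ∀ σ b → signℚ σ *ℚ bit (not b) ≡ signℚ σ *ℚ bit b +ℚ signℚ (flipDirection σ b)
flip-change Sign.+ false = refl
flip-change Sign.+ true = refl
flip-change Sign.- false = refl
flip-change Sign.- true = refl

moving : ∀ {n} → Sign → Vec Sign n → Assignment n → Vec Bool n
moving s [] [] = []
moving s (σ ∷ ε) (b ∷ p) = does (flipDirection σ b Signₚ.≟ s) ∷ moving s ε p

MovesFrom : ∀ {n} → Sign → Vec Sign n → Assignment n → Assignment n → Set
MovesFrom s ε p x = Σ ℚ λ K → (0ℚ Q.≤ K) × (x ≢ p → K ≢ 0ℚ) × (value ε x ≡ value ε p +ℚ signℚ s *ℚ K)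

moves-keep : ∀ {n} s σ (ε : Vec Sign n) b p x → MovesFrom s ε p x → MovesFrom s (σ ∷ ε) (b ∷ p) (b ∷ x)
moves-keep s σ ε b p x (K , 0≤K , K≢0 , fx) =
  K , 0≤K , (λ bx≢bp → K≢0 (λ x≡p → bx≢bp (cong (b ∷_) x≡p))) ,
  trans (cong (signℚ σ *ℚ bit b +ℚ_) fx) (shift-assoc (signℚ σ *ℚ bit b) (value ε p) (signℚ s) K)

moves-flip : ∀ {n} s σ (ε : Vec Sign n) b p x → flipDirection σ b ≡ s →
  MovesFrom s ε p x → MovesFrom s (σ ∷ ε) (b ∷ p) (not b ∷ x)
moves-flip s σ ε b p x refl (K , 0≤K , _ , fx) =
  1ℚ +ℚ K , QP.<⇒≤ 0<1+K , (λ _ 1+K≡0 → QP.<⇒≢ 0<1+K (sym 1+K≡0)) ,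
  trans (cong₂ _+ℚ_ (flip-change σ b) fx) (shift-step (signℚ σ *ℚ bit b) (signℚ s) (value ε p) K)
  where
  0<1+K : 0ℚ Q.< 1ℚ +ℚ K
  0<1+K = QP.+-mono-<-≤ (QP.positive⁻¹ 1ℚ) 0≤K

moves-on-subcube : ∀ {n} s (ε : Vec Sign n) p x → InSubcube p (moving s ε p) x → MovesFrom s ε p x
moves-on-subcube s [] [] [] _ =
  0ℚ , QP.≤-refl , (λ x≢p → ⊥-elim (x≢p refl)) , sym (cong (0ℚ +ℚ_) (QP.*-zeroʳ (signℚ s)))
moves-on-subcube s (σ ∷ ε) (b ∷ p) (c ∷ x) x∈ with flipDirection σ b Signₚ.≟ s
... | no _ with refl , x∈′ ← x∈ = moves-keep s σ ε b p x (moves-on-subcube s ε p x x∈′)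
... | yes dir with c Boolₚ.≟ b
...   | yes refl = moves-keep s σ ε b p x (moves-on-subcube s ε p x x∈)
...   | no  c≢b rewrite Boolₚ.¬-not c≢b = moves-flip s σ ε b p x dir (moves-on-subcube s ε p x x∈)

value-separates : ∀ {n} s (ε : Vec Sign n) p x → InSubcube p (moving s ε p) x → x ≢ p →
  value ε x ≢ value ε p
value-separates s ε p x x∈ x≢p fx≡fp with moves-on-subcube s ε p x x∈
... | K , _ , K≢0 , fx = *-nonZero _ _ (sign≢0 s) (K≢0 x≢p)
        (identityʳ-unique (value ε p) (signℚ s *ℚ K) (trans (sym fx) fx≡fp))

-- every coordinate moves f in one of the two directions
moving-dims : ∀ {n} (ε : Vec Sign n) p → dim (moving Sign.+ ε p) + dim (moving Sign.- ε p) ≡ n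
moving-dims [] [] = refl
moving-dims (σ ∷ ε) (b ∷ p) with flipDirection σ b
... | Sign.+ = cong suc (moving-dims ε p)
... | Sign.- = trans (ℕₚ.+-suc _ _) (cong suc (moving-dims ε p))

half-of-sum : ∀ {n} a b → a + b ≡ n → n ≤ a + a ⊎ n ≤ b + b
half-of-sum a b refl with ℕₚ.≤-total a b
... | inj₁ a≤b = inj₂ (ℕₚ.+-monoˡ-≤ b a≤b)
... | inj₂ b≤a = inj₁ (ℕₚ.+-monoʳ-≤ a b≤a)

-- If f is constant on the region avoiding E, and q lies in that region,
-- then the larger of the two moving subcubes at q is covered by E except
-- at q, so n ≤ 2|E|.
level-set-bound : ∀ {n} (ε : Vec Sign n) (E : List (Lin n)) q → Avoids E q →
  (∀ x → Avoids E x → value ε x ≡ value ε q) → n ≤ length E + length E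
level-set-bound {n} ε E q q-avoids constant =
  [ bound-by Sign.+ , bound-by Sign.- ]′ (half-of-sum (dim (moving Sign.+ ε q)) (dim (moving Sign.- ε q)) (moving-dims ε q))
  where
  covered-by-E : ∀ s → dim (moving s ε q) ≤ length E
  covered-by-E s = covering-bound q (moving s ε q) E q-avoids
    (λ x x∈ x≢q x-avoids → value-separates s ε q x x∈ x≢q (constant x x-avoids))
  bound-by : ∀ s → n ≤ dim (moving s ε q) + dim (moving s ε q) → n ≤ length E + length E
  bound-by s n≤2d = ℕₚ.≤-trans n≤2d (ℕₚ.+-mono-≤ (covered-by-E s) (covered-by-E s))

-- The adversary walk down a refutation

Falsifies : ∀ {n} → Assignment n → Clause n → Set
Falsifies x C = ∀ L → L ∈ C → eval L x ≢ 0ℚ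

-- Outcome of the walk below a node reached with forms Ls and subtree
-- size s: forms E, a point avoiding them, f constant on the region
-- avoiding E, and the cost bound 2^|E| ≤ 2^|Ls| · s.
record Pinned {n} (ε : Vec Sign n) (Ls : List (Lin n)) (s : ℕ) : Set where
  constructor pinned
  field
    forms  : List (Lin n)
    point  : Assignment n
    avoids : Avoids forms point
    level  : ∀ x → Avoids forms x → value ε x ≡ value ε point
    cost   : 2 ^ length forms ≤ 2 ^ length Ls * s

WalkFrom : ∀ {n} → Vec Sign n → Clause n → ℕ → Set
WalkFrom {n} ε P s = ∀ Ls (p : Assignment n) → Avoids Ls p →
  (∀ x → Avoids Ls x → Falsifies x P) → Pinned ε Ls s

Pinned-weaken : ∀ {n} {ε : Vec Sign n} {Ls Ls′ s s′} →
  2 ^ length Ls′ * s ≤ 2 ^ length Ls * s′ → Pinned ε Ls′ s → Pinned ε Ls s′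
Pinned-weaken le (pinned E q avoids level cost) = pinned E q avoids level (ℕₚ.≤-trans cost le)

search : ∀ n (P : Assignment n → Set) → (∀ x → Dec (P x)) → Dec (Σ (Assignment n) P)
search zero P P? with P? []
... | yes p = yes ([] , p)
... | no ¬p = no λ { ([] , p) → ¬p p }
search (suc n) P P? with search n (λ x → P (true ∷ x)) (λ x → P? _)
                       | search n (λ x → P (false ∷ x)) (λ x → P? _)
... | yes (x , p) | _ = yes (_ , p)
... | no _ | yes (x , p) = yes (_ , p)
... | no ¬p₁ | no ¬p₀ = no λ { (true ∷ x , p) → ¬p₁ (x , p) ; (false ∷ x , p) → ¬p₀ (x , p) }

-- Leaf ⟨f ≠ A⟩: every falsifying point has f = A.
hyp-step : ∀ {m} {ε : Vec Sign (suc m)} {C} → NotIm ε C → WalkFrom ε C (clauseSize C)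
hyp-step {ε = ε} {C} (A , _ , isNeq) Ls p p-avoids falsified =
  pinned Ls p p-avoids (λ x x-avoids → trans (equals-A x (falsified x x-avoids))
                                             (sym (equals-A p (falsified p p-avoids))))
         (subst (_≤ 2 ^ length Ls * clauseSize C) (ℕₚ.*-identityʳ _)
                (ℕₚ.*-monoʳ-≤ (2 ^ length Ls) (neq-clause-size ε C isNeq)))
  where
  equals-A : ∀ x → Falsifies x C → value ε x ≡ A
  equals-A x x-falsifies with value ε x QP.≟ A
  ... | yes fx≡A = fx≡A
  ... | no  fx≢A = ⊥-elim (x-falsifies (fEq ε (value ε x))
                            (proj₂ (isNeq (fEq ε (value ε x))) (value ε x) (x , refl) fx≢A) (fEq-holds ε _ x refl))

-- The axiom 0 = 0 is never falsified, so it is never reached.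
ax-step : ∀ {n} {ε : Vec Sign n} {s} → WalkFrom ε [ zeroEq ] s
ax-step Ls p p-avoids falsified = ⊥-elim (falsified p p-avoids zeroEq (here refl) (zeroEq-holds p))

-- Weakening C ⊨ D: points falsifying D falsify C.
weak-step : ∀ {n} {ε : Vec Sign n} {C D s} c → C ⊨ D → WalkFrom ε C s → WalkFrom ε D (c + s)
weak-step {s = s} c C⊨D walk Ls p p-avoids falsified =
  Pinned-weaken (ℕₚ.*-monoʳ-≤ (2 ^ length Ls) (ℕₚ.m≤n+m s c))
    (walk Ls p p-avoids (λ x x-avoids L L∈C Lx≡0 →
      let (L′ , L′∈D , L′x≡0) = find (C⊨D x (lose L∈C Lx≡0)) in falsified x x-avoids L′ L′∈D L′x≡0))

-- Entering the smaller premise (resolved form h) of a resolution step;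
-- the other premise has resolved form h′, nonzero wherever h vanishes.
-- If h is nonzero somewhere on the region, add h to the forms (cost
-- doubles, paid for by s ≤ s′); otherwise the other premise is
-- falsified on the whole region.
enter-smaller : ∀ {n} {ε : Vec Sign n} {P P′ : Clause n} {s s′} (h h′ : Lin n) Ls p → Avoids Ls p →
  (∀ x → Avoids Ls x → eval h x ≢ 0ℚ → Falsifies x P) →
  (∀ x → Avoids Ls x → eval h′ x ≢ 0ℚ → Falsifies x P′) →
  (∀ x → Avoids Ls x → eval h x ≡ 0ℚ → eval h′ x ≢ 0ℚ) →
  WalkFrom ε P s → WalkFrom ε P′ s′ → s ≤ s′ → Pinned ε Ls (s + s′)
enter-smaller {n} {s = s} {s′} h h′ Ls p p-avoids falsified falsified′ complement walk walk′ s≤s′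
  with search n (λ x → Avoids Ls x × eval h x ≢ 0ℚ) (λ x → avoids? Ls x ×-dec ¬? (eval h x QP.≟ 0ℚ))
... | yes (q , q-avoids , hq≢0) =
  Pinned-weaken doubled
    (walk (h ∷ Ls) q (hq≢0 ∷ q-avoids) (λ x x-avoids → falsified x (All.tail x-avoids) (All.head x-avoids)))
  where
  doubled : (2 * 2 ^ length Ls) * s ≤ 2 ^ length Ls * (s + s′)
  doubled = begin
    (2 * 2 ^ length Ls) * s    ≡⟨ double-product (2 ^ length Ls) s ⟩
    2 ^ length Ls * (s + s)    ≤⟨ ℕₚ.*-monoʳ-≤ (2 ^ length Ls) (ℕₚ.+-monoʳ-≤ s s≤s′) ⟩
    2 ^ length Ls * (s + s′)   ∎
    where open ℕₚ.≤-Reasoning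
... | no nowhere =
  Pinned-weaken (ℕₚ.*-monoʳ-≤ (2 ^ length Ls) (ℕₚ.m≤n+m s′ s))
    (walk′ Ls p p-avoids (λ x x-avoids → falsified′ x x-avoids (complement x x-avoids (vanishes x x-avoids))))
  where
  vanishes : ∀ x → Avoids Ls x → eval h x ≡ 0ℚ
  vanishes x x-avoids with eval h x QP.≟ 0ℚ
  ... | yes hx≡0 = hx≡0
  ... | no  hx≢0 = ⊥-elim (nowhere (x , x-avoids , hx≢0))

-- Resolution: points falsifying the conclusion falsify a premise once its
-- resolved form is nonzero; enter whichever premise is smaller.
res-step : ∀ {n} {ε : Vec Sign n} {P₁ P₂ Q} {C D : Clause n} {f g : Lin n} {α β s₁ s₂} c →
  P₁ ≈ (f ∷ C) → P₂ ≈ (g ∷ D) → Q ≈ (C ++ D ++ [ lincomb α f β g ]) →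
  WalkFrom ε P₁ s₁ → WalkFrom ε P₂ s₂ → WalkFrom ε Q (c + s₁ + s₂)
res-step {ε = ε} {P₁} {P₂} {_} {C} {D} {f} {g} {α} {β} {s₁} {s₂} c P₁≈ P₂≈ Q≈ walk₁ walk₂
         Ls p p-avoids falsified = enter (s₁ ≤? s₂)
  where
  in-Q : ∀ x → Avoids Ls x → Falsifies x (C ++ D ++ [ lincomb α f β g ])
  in-Q x x-avoids L L∈ = falsified x x-avoids L (proj₂ (Q≈ L) L∈)
  falsifies₁ : ∀ x → Avoids Ls x → eval f x ≢ 0ℚ → Falsifies x P₁
  falsifies₁ x x-avoids fx≢0 L L∈P₁ with proj₁ (P₁≈ L) L∈P₁
  ... | here refl = fx≢0
  ... | there L∈C = in-Q x x-avoids L (∈-++⁺ˡ L∈C)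
  falsifies₂ : ∀ x → Avoids Ls x → eval g x ≢ 0ℚ → Falsifies x P₂
  falsifies₂ x x-avoids gx≢0 L L∈P₂ with proj₁ (P₂≈ L) L∈P₂
  ... | here refl = gx≢0
  ... | there L∈D = in-Q x x-avoids L (∈-++⁺ʳ C (∈-++⁺ˡ L∈D))
  -- the resolvent αf + βg is nonzero on the region, so f and g never vanish together
  not-both-zero : ∀ x → Avoids Ls x → eval f x ≡ 0ℚ → eval g x ≡ 0ℚ → ⊥
  not-both-zero x x-avoids fx≡0 gx≡0 = in-Q x x-avoids _ (∈-++⁺ʳ C (∈-++⁺ʳ D (here refl))) (begin
    eval (lincomb α f β g) x           ≡⟨ eval-lincomb α β f g x ⟩
    α *ℚ eval f x +ℚ β *ℚ eval g x     ≡⟨ cong₂ (λ u v → α *ℚ u +ℚ β *ℚ v) fx≡0 gx≡0 ⟩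
    α *ℚ 0ℚ +ℚ β *ℚ 0ℚ                 ≡⟨ lincomb-zeros α β ⟩
    0ℚ                                 ∎)
    where open ≡-Reasoning
  budget : s₁ + s₂ ≤ c + s₁ + s₂
  budget = ℕₚ.≤-trans (ℕₚ.m≤n+m (s₁ + s₂) c) (ℕₚ.≤-reflexive (sym (ℕₚ.+-assoc c s₁ s₂)))
  enter : Dec (s₁ ≤ s₂) → Pinned ε Ls (c + s₁ + s₂)
  enter (yes s₁≤s₂) =
    Pinned-weaken (ℕₚ.*-monoʳ-≤ (2 ^ length Ls) budget)
      (enter-smaller f g Ls p p-avoids falsifies₁ falsifies₂
        (λ x x-avoids fx≡0 gx≡0 → not-both-zero x x-avoids fx≡0 gx≡0) walk₁ walk₂ s₁≤s₂)
  enter (no s₁≰s₂) =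
    Pinned-weaken (ℕₚ.*-monoʳ-≤ (2 ^ length Ls) (subst (_≤ c + s₁ + s₂) (ℕₚ.+-comm s₁ s₂) budget))
      (enter-smaller g f Ls p p-avoids falsifies₂ falsifies₁
        (λ x x-avoids gx≡0 fx≡0 → not-both-zero x x-avoids fx≡0 gx≡0) walk₂ walk₁ (ℕₚ.<⇒≤ (ℕₚ.≰⇒> s₁≰s₂)))

walk : ∀ {m} {ε : Vec Sign (suc m)} {Q} (d : Deriv (NotIm ε) Q) → WalkFrom ε Q (size d)
walk (hyp h) = hyp-step h
walk ax = ax-step
walk (weak {D = D} d C⊨D) = weak-step (clauseSize D) C⊨D (walk d)
walk (res {Q = Q} C D f g α β d₁ d₂ P₁≈ P₂≈ Q≈) =
  res-step {α = α} {β} (clauseSize Q) P₁≈ P₂≈ Q≈ (walk d₁) (walk d₂)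

exponent-bound : ∀ {n k S} → n ≤ k + k → 2 ^ k ≤ S → 2 ^ n ≤ S ^ 4
exponent-bound {n} {k} {S} n≤2k 2^k≤S = ℕₚ.≤-trans 2^n≤S² S²≤S⁴
  where
  open ℕₚ.≤-Reasoning
  instance
    S-nonZero : NonZero S
    S-nonZero = >-nonZero (ℕₚ.≤-trans (ℕₚ.^-monoʳ-≤ 2 {0} {k} z≤n) 2^k≤S)
  2^n≤S² : 2 ^ n ≤ S ^ 2
  2^n≤S² = begin
    2 ^ n              ≤⟨ ℕₚ.^-monoʳ-≤ 2 n≤2k ⟩
    2 ^ (k + k)        ≡⟨ ℕₚ.^-distribˡ-+-* 2 k k ⟩
    2 ^ k * 2 ^ k      ≤⟨ ℕₚ.*-mono-≤ 2^k≤S 2^k≤S ⟩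
    S * S              ≡⟨ cong (S *_) (sym (ℕₚ.*-identityʳ S)) ⟩
    S ^ 2              ∎
  S²≤S⁴ : S ^ 2 ≤ S ^ 4
  S²≤S⁴ = ℕₚ.^-monoʳ-≤ S {2} {4} (s≤s (s≤s z≤n))

mainTheorem6 : (n : ℕ) → 1 ≤ n → (ε : Vec Sign n) →
    (π : Refutation (NotIm ε)) → 2 ^ n ≤ size π ^ 4
mainTheorem6 zero () ε π
mainTheorem6 (suc m) _ ε π =
  exponent-bound {k = length forms} (level-set-bound ε forms point avoids level)
                 (subst (2 ^ length forms ≤_) (ℕₚ.*-identityˡ (size π)) cost)
  where
  -- start at the root with no forms: the empty clause is falsified everywhere
  open Pinned (walk π [] (replicate (suc m) false) [] (λ x _ L ()))
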